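{- Let $q\in\mathbb{C}$ with $0<|q|<1$ and $a\in\mathbb{C}$. Let $B_{n,1}(a,0)$ ($n\ge1$) be the unique complex numbers with $$z=\sum_{n=1}^\infty B_{n,1}(a,0)\,z^n(az;q)_n\quad\text{in }\mathbb{C}[[z]].$$ Then every $F(z)\in\mathbb{C}[[z]]$ has the expansion $$F(z)=\sum_{n=0}^{\infty}c_nz^{n}(az;q)_n,$$ where $$c_n=[z^{n}]\left\{\frac{F(z)}{(az;q)_n}\right\}-a\sum_{k=0}^{n-1}B_{n-k,1}(a,0)\,q^{(n-k)k}\,[z^{k}]\left\{\frac{F(z)}{(az;q)_{k+1}}\right\}.$$
   Context: $(x;q)_n=\prod_{i=0}^{n-1}(1-xq^i)$ for $n\ge0$, with $(x;q)_0=1$; $1/(az;q)_n$ is expanded as a formal power series in $z$; $[z^m]\{f(z)\}$ is the coefficient of $z^m$ in $f\in\mathbb{C}[[z]]$; an empty sum is $0$. -}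

module Defs where

open import Level using (Level)
open import Data.Nat using (ℕ; zero; suc; _∸_) renaming (_*_ to _*ℕ_; _+_ to _+ℕ_)
open import Algebra.Bundles using (CommutativeRing)

-- Formal power series over a commutative ring R, represented by their
-- coefficient sequences: f n = [z^n] f.
module PS {c ℓ : Level} (R : CommutativeRing c ℓ) where
  open CommutativeRing R

  Series : Set c
  Series = ℕ → Carrier

  pow : Carrier → ℕ → Carrier
  pow x zero    = 1#
  pow x (suc n) = x * pow x n

  sumTo : (ℕ → Carrier) → ℕ → Carrier
  sumTo f zero    = 0#
  sumTo f (suc n) = sumTo f n + f n

  coeff : ℕ → Series → Carrier
  coeff m f = f m

  one : Series
  one zero    = 1#
  one (suc _) = 0#

  zSeries : Series
  zSeries zero          = 0#
  zSeries (suc zero)    = 1#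
  zSeries (suc (suc _)) = 0#

  mul : Series → Series → Series
  mul f g n = sumTo (λ k → f k * g (n ∸ k)) (suc n)

  shiftZ : ℕ → Series → Series
  shiftZ zero    f m       = f m
  shiftZ (suc n) f zero    = 0#
  shiftZ (suc n) f (suc m) = shiftZ n f m

  oneMinus : Carrier → Series
  oneMinus x zero          = 1#
  oneMinus x (suc zero)    = - x
  oneMinus x (suc (suc _)) = 0#

  geo : Carrier → Series
  geo x j = pow x j

  poch : Carrier → Carrier → ℕ → Series
  poch a q zero    = one
  poch a q (suc n) = mul (poch a q n) (oneMinus (a * pow q n))

  -- 1/(az;q)_n expanded as a formal power series in z:
  -- Π_{i<n} 1/(1 - a q^i z)
  invPoch : Carrier → Carrier → ℕ → Series
  invPoch a q zero    = one
  invPoch a q (suc n) = mul (invPoch a q n) (geo (a * pow q n))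

  basis : Carrier → Carrier → ℕ → Series
  basis a q n = shiftZ n (poch a q n)

  -- [z^m] of the (formally convergent) sum Σ_{n≥0} d_n z^n (az;q)_n ;
  -- terms with n > m have order > m, so only n ≤ m contribute.
  expansion : Carrier → Carrier → (ℕ → Carrier) → Series
  expansion a q d m = sumTo (λ n → d n * basis a q n m) (suc m)

  -- [z^m] of Σ_{n≥1} B_n z^n (az;q)_n  (B 0 is ignored)
  expansion₁ : Carrier → Carrier → (ℕ → Carrier) → Series
  expansion₁ a q B m = sumTo (λ k → B (suc k) * basis a q (suc k) m) m

  cCoeff : Carrier → Carrier → (ℕ → Carrier) → Series → ℕ → Carrier
  cCoeff a q B F n =
    coeff n (mul F (invPoch a q n))
    - a * sumTo (λ k → B (n ∸ k) * pow q ((n ∸ k) *ℕ k)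
                        * coeff k (mul F (invPoch a q (suc k)))) n

module Submission where

-- Write Y_N = F/(az;q)_N, x_N = a q^N and d_k = [z^k] Y_{k+1}.  Since
-- Y_N = (1 - x_N z) Y_{N+1}, stripping the leading coefficient off
-- z^N (az;q)_N · (Y_N without its first N terms) telescopes to
--   F = Σ_k Y_k(k) z^k (az;q)_k  -  Σ_k x_k d_k z^{k+1} (az;q)_k.      (1)
-- Substituting z ↦ q^k z in the defining identity of B and multiplying
-- by z^k (az;q)_k expresses each q^k z^{k+1}(az;q)_k in the basis:
--   q^k z^{k+1}(az;q)_k = Σ_j B_{j+1} q^{(j+1)k} z^{k+j+1}(az;q)_{k+j+1}.  (2)
-- Inserting (2) into the second sum of (1) and reindexing the resulting
-- triangular double sum gives  Σ_n a (Σ_{k<n} B_{n-k} q^{(n-k)k} d_k) ·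
-- z^n (az;q)_n, which is exactly the correction term of c_n.

open import Level using (Level)
open import Data.Nat using (ℕ; zero; suc; _∸_; _≤_; _<_; _≤′_; ≤′-refl; ≤′-step; s≤s)
  renaming (_*_ to _*ℕ_; _+_ to _+ℕ_)
import Data.Nat.Properties as ℕ
open import Algebra.Bundles using (CommutativeRing)
import Relation.Binary.PropositionalEquality as ≡
open import Defs

module Expansion {c ℓ : Level} (R : CommutativeRing c ℓ) where
  open CommutativeRing R
  open PS R
  open import Algebra.Properties.Ring ring using (-‿distribˡ-*; -‿distribʳ-*)
  open import Algebra.Properties.AbelianGroup +-abelianGroup using (⁻¹-∙-comm)
  open import Algebra.Solver.Ring.NaturalCoefficients.Default commutativeSemiring
  open import Relation.Binary.Reasoning.Setoid setoid public

  -- Finite sums Σ_{k<n}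

  sumTo-cong : ∀ {f g} n → (∀ k → k < n → f k ≈ g k) → sumTo f n ≈ sumTo g n
  sumTo-cong zero    e = refl
  sumTo-cong (suc n) e =
    +-cong (sumTo-cong n (λ k k<n → e k (ℕ.m<n⇒m<1+n k<n))) (e n ℕ.≤-refl)

  sumTo-zero : ∀ {f} n → (∀ k → f k ≈ 0#) → sumTo f n ≈ 0#
  sumTo-zero zero    e = refl
  sumTo-zero (suc n) e = trans (+-cong (sumTo-zero n e) (e n)) (+-identityʳ 0#)

  sumTo-+ : ∀ f g n → sumTo (λ k → f k + g k) n ≈ sumTo f n + sumTo g n
  sumTo-+ f g zero    = sym (+-identityʳ 0#)
  sumTo-+ f g (suc n) = trans (+-cong (sumTo-+ f g n) refl)
    (solve 4 (λ s t u v → (s :+ t) :+ (u :+ v) := (s :+ u) :+ (t :+ v)) refl _ _ _ _)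

  sumTo-minus : ∀ f g n → sumTo (λ k → f k - g k) n ≈ sumTo f n - sumTo g n
  sumTo-minus f g zero    = sym (-‿inverseʳ 0#)
  sumTo-minus f g (suc n) = trans (+-cong (sumTo-minus f g n) refl)
    (trans (solve 4 (λ s t u v → (s :+ t) :+ (u :+ v) := (s :+ u) :+ (t :+ v)) refl _ _ _ _)
           (+-cong refl (⁻¹-∙-comm _ _)))

  sumTo-*ˡ : ∀ x f n → x * sumTo f n ≈ sumTo (λ k → x * f k) n
  sumTo-*ˡ x f zero    = zeroʳ x
  sumTo-*ˡ x f (suc n) = trans (distribˡ x _ _) (+-cong (sumTo-*ˡ x f n) refl)

  sumTo-*ʳ : ∀ x f n → sumTo f n * x ≈ sumTo (λ k → f k * x) n
  sumTo-*ʳ x f zero    = zeroˡ x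
  sumTo-*ʳ x f (suc n) = trans (distribʳ x _ _) (+-cong (sumTo-*ʳ x f n) refl)

  sumTo-first : ∀ f n → sumTo f (suc n) ≈ f 0 + sumTo (λ k → f (suc k)) n
  sumTo-first f zero    = trans (+-identityˡ _) (sym (+-identityʳ _))
  sumTo-first f (suc n) = trans (+-cong (sumTo-first f n) refl) (+-assoc _ _ _)

  sumTo-swap : ∀ (h : ℕ → ℕ → Carrier) N M →
    sumTo (λ i → sumTo (h i) M) N ≈ sumTo (λ j → sumTo (λ i → h i j) N) M
  sumTo-swap h zero    M = sym (sumTo-zero M (λ _ → refl))
  sumTo-swap h (suc N) M =
    trans (+-cong (sumTo-swap h N M) refl) (sym (sumTo-+ _ (h N) M))

  sumTo-reverse : ∀ f n → sumTo f (suc n) ≈ sumTo (λ k → f (n ∸ k)) (suc n)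
  sumTo-reverse f zero    = refl
  sumTo-reverse f (suc n) = begin
    sumTo f (suc n) + f (suc n)                   ≈⟨ +-cong (sumTo-reverse f n) refl ⟩
    sumTo (λ k → f (n ∸ k)) (suc n) + f (suc n)   ≈⟨ +-comm _ _ ⟩
    f (suc n) + sumTo (λ k → f (n ∸ k)) (suc n)   ≈⟨ sumTo-first (λ k → f (suc n ∸ k)) (suc n) ⟨
    sumTo (λ k → f (suc n ∸ k)) (suc (suc n))     ∎

  sumTo-pad : ∀ f {n N} → n ≤ N → (∀ j → n ≤ j → f j ≈ 0#) → sumTo f N ≈ sumTo f n
  sumTo-pad f {n} n≤N vanish = go (ℕ.≤⇒≤′ n≤N)
    where
    go : ∀ {N} → n ≤′ N → sumTo f N ≈ sumTo f n
    go ≤′-refl          = refl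
    go (≤′-step {N} p) = trans (+-cong (go p) (vanish N (ℕ.≤′⇒≤ p))) (+-identityʳ _)

  sumTo-triangle : ∀ (G : ℕ → ℕ → Carrier) N →
    sumTo (λ n → sumTo (G n) n) N ≈
    sumTo (λ k → sumTo (λ j → G (k +ℕ suc j) k) (N ∸ suc k)) N
  sumTo-triangle G zero    = refl
  sumTo-triangle G (suc N) = begin
    sumTo (λ n → sumTo (G n) n) N + sumTo (G N) N
      ≈⟨ +-cong (sumTo-triangle G N) refl ⟩
    sumTo (λ k → inner k (N ∸ suc k)) N + sumTo (G N) N
      ≈⟨ sumTo-+ _ (G N) N ⟨
    sumTo (λ k → inner k (N ∸ suc k) + G N k) N
      ≈⟨ sumTo-cong N (λ k k<N → sym (inner-step k k<N)) ⟩
    sumTo (λ k → inner k (N ∸ k)) N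
      ≈⟨ +-identityʳ _ ⟨
    sumTo (λ k → inner k (N ∸ k)) N + 0#
      ≈⟨ +-cong refl (reflexive (≡.cong (inner N) (≡.sym (ℕ.n∸n≡0 N)))) ⟩
    sumTo (λ k → inner k (N ∸ k)) N + inner N (N ∸ N) ∎
    where
    inner : ℕ → ℕ → Carrier
    inner k t = sumTo (λ j → G (k +ℕ suc j) k) t
    inner-step : ∀ k → k < N → inner k (N ∸ k) ≈ inner k (N ∸ suc k) + G N k
    inner-step k k<N = trans (reflexive (≡.cong (inner k) (ℕ.+-∸-assoc 1 k<N)))
      (+-cong refl (reflexive (≡.cong (λ t → G t k)
        (≡.trans (ℕ.+-suc k (N ∸ suc k)) (ℕ.m+[n∸m]≡n k<N)))))

  -- The ring of formal power series

  infix 4 _≋_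
  _≋_ : Series → Series → Set ℓ
  f ≋ g = ∀ n → f n ≈ g n

  add : Series → Series → Series
  add f g n = f n + g n

  scal : Carrier → Series → Series
  scal x f n = x * f n

  tl : Series → Series
  tl f n = f (suc n)

  mul-coeff₀ : ∀ f g → mul f g 0 ≈ f 0 * g 0
  mul-coeff₀ f g = +-identityˡ _

  mul-coeffₛ : ∀ f g n → mul f g (suc n) ≈ f 0 * g (suc n) + mul (tl f) g n
  mul-coeffₛ f g n = sumTo-first (λ k → f k * g (suc n ∸ k)) (suc n)

  -- Ring laws for series multiplication (commutativity by reversing the
  -- convolution sum, associativity by induction on the degree).
  mul-cong : ∀ {f f′ g g′} → f ≋ f′ → g ≋ g′ → mul f g ≋ mul f′ g′
  mul-cong ef eg n = sumTo-cong (suc n) (λ k _ → *-cong (ef k) (eg (n ∸ k)))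

  mul-distribˡ : ∀ f g h → mul f (add g h) ≋ add (mul f g) (mul f h)
  mul-distribˡ f g h n =
    trans (sumTo-cong (suc n) (λ k _ → distribˡ _ _ _)) (sumTo-+ _ _ (suc n))

  mul-distribʳ : ∀ f g h → mul (add f g) h ≋ add (mul f h) (mul g h)
  mul-distribʳ f g h n =
    trans (sumTo-cong (suc n) (λ k _ → distribʳ _ _ _)) (sumTo-+ _ _ (suc n))

  mul-scalˡ : ∀ x f g → mul (scal x f) g ≋ scal x (mul f g)
  mul-scalˡ x f g n = trans (sumTo-cong (suc n) (λ k _ → *-assoc _ _ _))
                            (sym (sumTo-*ˡ x _ (suc n)))

  mul-scalʳ : ∀ x f g → mul f (scal x g) ≋ scal x (mul f g)
  mul-scalʳ x f g n =
    trans (sumTo-cong (suc n) (λ k _ → solve 3 (λ u x v → u :* (x :* v) := x :* (u :* v)) refl _ _ _))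
          (sym (sumTo-*ˡ x _ (suc n)))

  mul-comm : ∀ f g → mul f g ≋ mul g f
  mul-comm f g n = begin
    sumTo (λ k → f k * g (n ∸ k)) (suc n)
      ≈⟨ sumTo-reverse _ n ⟩
    sumTo (λ k → f (n ∸ k) * g (n ∸ (n ∸ k))) (suc n)
      ≈⟨ sumTo-cong (suc n) (λ k k≤n → trans (*-comm _ _)
           (*-cong (reflexive (≡.cong g (ℕ.m∸[m∸n]≡n (ℕ.≤-pred k≤n)))) refl)) ⟩
    sumTo (λ k → g k * f (n ∸ k)) (suc n) ∎

  mul-assoc : ∀ f g h → mul (mul f g) h ≋ mul f (mul g h)
  mul-assoc f g h zero = begin
    mul (mul f g) h 0     ≈⟨ trans (mul-coeff₀ (mul f g) h) (*-cong (mul-coeff₀ f g) refl) ⟩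
    (f 0 * g 0) * h 0     ≈⟨ *-assoc _ _ _ ⟩
    f 0 * (g 0 * h 0)     ≈⟨ trans (mul-coeff₀ f (mul g h)) (*-cong refl (mul-coeff₀ g h)) ⟨
    mul f (mul g h) 0     ∎
  mul-assoc f g h (suc n) = begin
    mul (mul f g) h (suc n)
      ≈⟨ mul-coeffₛ (mul f g) h n ⟩
    mul f g 0 * h (suc n) + mul (tl (mul f g)) h n
      ≈⟨ +-cong (*-cong (mul-coeff₀ f g) refl) (mul-cong {g = h} (mul-coeffₛ f g) (λ _ → refl) n) ⟩
    (f 0 * g 0) * h (suc n) + mul (add (scal (f 0) (tl g)) (mul (tl f) g)) h n
      ≈⟨ +-cong refl (mul-distribʳ (scal (f 0) (tl g)) (mul (tl f) g) h n) ⟩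
    (f 0 * g 0) * h (suc n) + (mul (scal (f 0) (tl g)) h n + mul (mul (tl f) g) h n)
      ≈⟨ +-cong refl (+-cong (mul-scalˡ (f 0) (tl g) h n) (mul-assoc (tl f) g h n)) ⟩
    (f 0 * g 0) * h (suc n) + (f 0 * mul (tl g) h n + mul (tl f) (mul g h) n)
      ≈⟨ solve 5 (λ u v w x y → (u :* v) :* w :+ (u :* x :+ y) := u :* (v :* w :+ x) :+ y)
           refl _ _ _ _ _ ⟩
    f 0 * (g 0 * h (suc n) + mul (tl g) h n) + mul (tl f) (mul g h) n
      ≈⟨ +-cong (*-cong refl (mul-coeffₛ g h n)) refl ⟨
    f 0 * mul g h (suc n) + mul (tl f) (mul g h) n
      ≈⟨ mul-coeffₛ f (mul g h) n ⟨
    mul f (mul g h) (suc n) ∎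

  mul-identityˡ : ∀ f → mul one f ≋ f
  mul-identityˡ f zero    = trans (mul-coeff₀ one f) (*-identityˡ _)
  mul-identityˡ f (suc n) = begin
    mul one f (suc n)                   ≈⟨ mul-coeffₛ one f n ⟩
    1# * f (suc n) + mul (tl one) f n   ≈⟨ +-cong (*-identityˡ _) (sumTo-zero (suc n) (λ _ → zeroˡ _)) ⟩
    f (suc n) + 0#                      ≈⟨ +-identityʳ _ ⟩
    f (suc n)                           ∎

  mul-identityʳ : ∀ f → mul f one ≋ f
  mul-identityʳ f n = trans (mul-comm f one n) (mul-identityˡ f n)

  -- Multiplication distributes over a sum Σ_j u_j in which u_j has no terms
  -- of degree ≤ j, so that only j < M contribute to the coefficient of z^M.
  mul-locallyFinite : ∀ f (u : ℕ → Series) → (∀ j M → M ≤ j → u j M ≈ 0#) →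
    ∀ m → mul f (λ M → sumTo (λ j → u j M) M) m ≈ sumTo (λ j → mul f (u j) m) m
  mul-locallyFinite f u u-low m = begin
    sumTo (λ i → f i * sumTo (λ j → u j (m ∸ i)) (m ∸ i)) (suc m)
      ≈⟨ sumTo-cong (suc m) (λ i _ → *-cong refl
           (sym (sumTo-pad (λ j → u j (m ∸ i)) (ℕ.m∸n≤m m i) (λ j → u-low j (m ∸ i))))) ⟩
    sumTo (λ i → f i * sumTo (λ j → u j (m ∸ i)) m) (suc m)
      ≈⟨ sumTo-cong (suc m) (λ i _ → sumTo-*ˡ (f i) _ m) ⟩
    sumTo (λ i → sumTo (λ j → f i * u j (m ∸ i)) m) (suc m)
      ≈⟨ sumTo-swap (λ i j → f i * u j (m ∸ i)) (suc m) m ⟩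
    sumTo (λ j → mul f (u j) m) m ∎

  shift-cong : ∀ {f g} k → f ≋ g → shiftZ k f ≋ shiftZ k g
  shift-cong zero    e m       = e m
  shift-cong (suc k) e zero    = refl
  shift-cong (suc k) e (suc m) = shift-cong k e m

  shift-low : ∀ k f m → m < k → shiftZ k f m ≈ 0#
  shift-low (suc k) f zero    _         = refl
  shift-low (suc k) f (suc m) (s≤s m<k) = shift-low k f m m<k

  shift-add : ∀ k f g → shiftZ k (add f g) ≋ add (shiftZ k f) (shiftZ k g)
  shift-add zero    f g m       = refl
  shift-add (suc k) f g zero    = sym (+-identityʳ 0#)
  shift-add (suc k) f g (suc m) = shift-add k f g m

  shift-scal : ∀ k x f → shiftZ k (scal x f) ≋ scal x (shiftZ k f)
  shift-scal zero    x f m       = refl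
  shift-scal (suc k) x f zero    = sym (zeroʳ x)
  shift-scal (suc k) x f (suc m) = shift-scal k x f m

  shift-shift : ∀ k n f m → shiftZ k (shiftZ n f) m ≡.≡ shiftZ (k +ℕ n) f m
  shift-shift zero    n f m       = ≡.refl
  shift-shift (suc k) n f zero    = ≡.refl
  shift-shift (suc k) n f (suc m) = shift-shift k n f m

  shift-suc : ∀ k f m → shiftZ k (shiftZ 1 f) m ≈ shiftZ (suc k) f m
  shift-suc k f m =
    reflexive (≡.trans (shift-shift k 1 f m) (≡.cong (λ t → shiftZ t f m) (ℕ.+-comm k 1)))

  shift-mulˡ : ∀ k f g → mul (shiftZ k f) g ≋ shiftZ k (mul f g)
  shift-mulˡ zero    f g n       = refl
  shift-mulˡ (suc k) f g zero    = trans (mul-coeff₀ (shiftZ (suc k) f) g) (zeroˡ _)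
  shift-mulˡ (suc k) f g (suc n) = begin
    mul (shiftZ (suc k) f) g (suc n)
      ≈⟨ mul-coeffₛ (shiftZ (suc k) f) g n ⟩
    0# * g (suc n) + mul (shiftZ k f) g n
      ≈⟨ +-cong (zeroˡ _) (shift-mulˡ k f g n) ⟩
    0# + shiftZ k (mul f g) n
      ≈⟨ +-identityˡ _ ⟩
    shiftZ k (mul f g) n ∎

  shift-mulʳ : ∀ k f g → mul f (shiftZ k g) ≋ shiftZ k (mul f g)
  shift-mulʳ k f g n = trans (mul-comm f (shiftZ k g) n)
    (trans (shift-mulˡ k g f n) (shift-cong k (mul-comm g f) n))

  mul-z : ∀ f → mul f zSeries ≋ shiftZ 1 f
  mul-z f n = trans (mul-cong {f = f} (λ _ → refl) z≋shift₁ n)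
                    (trans (shift-mulʳ 1 f one n) (shift-cong 1 (mul-identityʳ f) n))
    where
    z≋shift₁ : zSeries ≋ shiftZ 1 one
    z≋shift₁ zero          = refl
    z≋shift₁ (suc zero)    = refl
    z≋shift₁ (suc (suc n)) = refl

  oneMinus-cong : ∀ {x y} → x ≈ y → oneMinus x ≋ oneMinus y
  oneMinus-cong e zero          = refl
  oneMinus-cong e (suc zero)    = -‿cong e
  oneMinus-cong e (suc (suc n)) = refl

  mul-oneMinus₀ : ∀ x h → mul (oneMinus x) h 0 ≈ h 0
  mul-oneMinus₀ x h = trans (mul-coeff₀ (oneMinus x) h) (*-identityˡ _)

  mul-oneMinusₛ : ∀ x h n → mul (oneMinus x) h (suc n) ≈ h (suc n) - x * h n
  mul-oneMinusₛ x h n = begin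
    mul (oneMinus x) h (suc n)
      ≈⟨ mul-coeffₛ (oneMinus x) h n ⟩
    1# * h (suc n) + mul (tl (oneMinus x)) h n
      ≈⟨ +-cong (*-identityˡ _) (mul-cong {g = h} tl-oneMinus (λ _ → refl) n) ⟩
    h (suc n) + mul (scal (- x) one) h n
      ≈⟨ +-cong refl (trans (mul-scalˡ (- x) one h n) (*-cong refl (mul-identityˡ h n))) ⟩
    h (suc n) + - x * h n
      ≈⟨ +-cong refl (-‿distribˡ-* x (h n)) ⟨
    h (suc n) - x * h n ∎
    where
    tl-oneMinus : tl (oneMinus x) ≋ scal (- x) one
    tl-oneMinus zero    = sym (*-identityʳ _)
    tl-oneMinus (suc n) = sym (zeroʳ _)

  mul-geoₛ : ∀ x h n → mul (geo x) h (suc n) ≈ h (suc n) + x * mul (geo x) h n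
  mul-geoₛ x h n = trans (mul-coeffₛ (geo x) h n)
    (+-cong (*-identityˡ _) (mul-scalˡ x (geo x) h n))

  pow-+ : ∀ x i j → pow x (i +ℕ j) ≈ pow x i * pow x j
  pow-+ x zero    j = sym (*-identityˡ _)
  pow-+ x (suc i) j = trans (*-cong refl (pow-+ x i j)) (sym (*-assoc _ _ _))

  pow-pow : ∀ x k n → pow (pow x k) n ≈ pow x (n *ℕ k)
  pow-pow x k zero    = refl
  pow-pow x k (suc n) = trans (*-cong refl (pow-pow x k n)) (sym (pow-+ x k (n *ℕ k)))

  dilate : Carrier → Series → Series
  dilate c f m = pow c m * f m

  dilate-mul : ∀ c f g → dilate c (mul f g) ≋ mul (dilate c f) (dilate c g)
  dilate-mul c f g m = begin
    pow c m * sumTo (λ k → f k * g (m ∸ k)) (suc m)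
      ≈⟨ sumTo-*ˡ _ _ (suc m) ⟩
    sumTo (λ k → pow c m * (f k * g (m ∸ k))) (suc m)
      ≈⟨ sumTo-cong (suc m) (λ k k≤m → split k (ℕ.≤-pred k≤m)) ⟩
    sumTo (λ k → (pow c k * f k) * (pow c (m ∸ k) * g (m ∸ k))) (suc m) ∎
    where
    split : ∀ k → k ≤ m →
      pow c m * (f k * g (m ∸ k)) ≈ (pow c k * f k) * (pow c (m ∸ k) * g (m ∸ k))
    split k k≤m = begin
      pow c m * (f k * g (m ∸ k))
        ≈⟨ *-cong (reflexive (≡.cong (pow c) (≡.sym (ℕ.m+[n∸m]≡n k≤m)))) refl ⟩
      pow c (k +ℕ (m ∸ k)) * (f k * g (m ∸ k))
        ≈⟨ *-cong (pow-+ c k (m ∸ k)) refl ⟩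
      (pow c k * pow c (m ∸ k)) * (f k * g (m ∸ k))
        ≈⟨ solve 4 (λ u v x y → (u :* v) :* (x :* y) := (u :* x) :* (v :* y)) refl _ _ _ _ ⟩
      (pow c k * f k) * (pow c (m ∸ k) * g (m ∸ k)) ∎

  dilate-one : ∀ c → dilate c one ≋ one
  dilate-one c zero    = *-identityˡ _
  dilate-one c (suc m) = zeroʳ _

  dilate-oneMinus : ∀ c x → dilate c (oneMinus x) ≋ oneMinus (c * x)
  dilate-oneMinus c x zero          = *-identityˡ _
  dilate-oneMinus c x (suc zero)    = begin
    (c * 1#) * - x   ≈⟨ *-cong (*-identityʳ c) refl ⟩
    c * - x          ≈⟨ -‿distribʳ-* c x ⟨
    - (c * x)        ∎
  dilate-oneMinus c x (suc (suc m)) = zeroʳ _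

  dilate-poch : ∀ c a q j → dilate c (poch a q j) ≋ poch (a * c) q j
  dilate-poch c a q zero    = dilate-one c
  dilate-poch c a q (suc j) m =
    trans (dilate-mul c (poch a q j) (oneMinus (a * pow q j)) m)
      (mul-cong (dilate-poch c a q j)
        (λ n → trans (dilate-oneMinus c _ n) (oneMinus-cong reorder n)) m)
    where
    reorder : c * (a * pow q j) ≈ (a * c) * pow q j
    reorder = solve 3 (λ c a p → c :* (a :* p) := (a :* c) :* p) refl c a (pow q j)

  dilate-shift : ∀ c n f → dilate c (shiftZ n f) ≋ scal (pow c n) (shiftZ n (dilate c f))
  dilate-shift c zero    f m       = sym (*-identityˡ _)
  dilate-shift c (suc n) f zero    = trans (zeroʳ _) (sym (zeroʳ _))
  dilate-shift c (suc n) f (suc m) = begin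
    (c * pow c m) * shiftZ n f m        ≈⟨ *-assoc _ _ _ ⟩
    c * (pow c m * shiftZ n f m)        ≈⟨ *-cong refl (dilate-shift c n f m) ⟩
    c * (pow c n * shiftZ n (dilate c f) m) ≈⟨ *-assoc _ _ _ ⟨
    (c * pow c n) * shiftZ n (dilate c f) m ∎

  dilate-z : ∀ c → dilate c zSeries ≋ scal c zSeries
  dilate-z c zero          = trans (zeroʳ _) (sym (zeroʳ _))
  dilate-z c (suc zero)    = *-identityʳ _
  dilate-z c (suc (suc m)) = trans (zeroʳ _) (sym (zeroʳ _))

  poch-split : ∀ a q k j → mul (poch a q k) (poch (a * pow q k) q j) ≋ poch a q (k +ℕ j)
  poch-split a q k zero n = trans (mul-identityʳ _ n)
    (reflexive (≡.cong (λ t → poch a q t n) (≡.sym (ℕ.+-identityʳ k))))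
  poch-split a q k (suc j) n = begin
    mul (poch a q k) (mul (poch (a * pow q k) q j) (oneMinus ((a * pow q k) * pow q j))) n
      ≈⟨ mul-assoc (poch a q k) (poch (a * pow q k) q j) (oneMinus ((a * pow q k) * pow q j)) n ⟨
    mul (mul (poch a q k) (poch (a * pow q k) q j)) (oneMinus ((a * pow q k) * pow q j)) n
      ≈⟨ mul-cong (poch-split a q k j) (oneMinus-cong merge) n ⟩
    poch a q (suc (k +ℕ j)) n
      ≈⟨ reflexive (≡.cong (λ t → poch a q t n) (≡.sym (ℕ.+-suc k j))) ⟩
    poch a q (k +ℕ suc j) n ∎
    where
    merge : (a * pow q k) * pow q j ≈ a * pow q (k +ℕ j)
    merge = trans (*-assoc _ _ _) (*-cong refl (sym (pow-+ q k j)))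

  basis-mul : ∀ a q k j → mul (basis a q k) (basis (a * pow q k) q j) ≋ basis a q (k +ℕ j)
  basis-mul a q k j m = begin
    mul (shiftZ k (poch a q k)) (shiftZ j (poch (a * pow q k) q j)) m
      ≈⟨ shift-mulˡ k (poch a q k) (basis (a * pow q k) q j) m ⟩
    shiftZ k (mul (poch a q k) (shiftZ j (poch (a * pow q k) q j))) m
      ≈⟨ shift-cong k (λ n → trans (shift-mulʳ j (poch a q k) (poch (a * pow q k) q j) n) (shift-cong j (poch-split a q k j) n)) m ⟩
    shiftZ k (shiftZ j (poch a q (k +ℕ j))) m
      ≈⟨ reflexive (shift-shift k j _ m) ⟩
    basis a q (k +ℕ j) m ∎

  zBasis : Carrier → Carrier → ℕ → Series
  zBasis a q k = shiftZ (suc k) (poch a q k)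

  dilate-basis : ∀ c a q n → dilate c (basis a q n) ≋ scal (pow c n) (basis (a * c) q n)
  dilate-basis c a q n M = trans (dilate-shift c n (poch a q n) M)
    (*-cong refl (shift-cong n (dilate-poch c a q n) M))

  basis-z : ∀ a q k → mul (basis a q k) zSeries ≋ zBasis a q k
  basis-z a q k m = trans (mul-z (basis a q k) m) (reflexive (shift-shift 1 k (poch a q k) m))

  -- Formula (1): telescoping the expansion of F

  cancelʳ : ∀ y w → (y + w) - w ≈ y
  cancelʳ y w = trans (+-assoc _ _ _) (trans (+-cong refl (-‿inverseʳ w)) (+-identityʳ y))

  cancelˡ : ∀ y w → - w + (y + w) ≈ y
  cancelˡ y w = trans (+-comm _ _) (cancelʳ y w)

  drop : ℕ → Series → Series
  drop N f i = f (i +ℕ N)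

  linear : Carrier → Carrier → Series
  linear u v = add (scal u one) (scal v zSeries)

  mul-linear : ∀ f u v → mul f (linear u v) ≋ add (scal u f) (scal v (shiftZ 1 f))
  mul-linear f u v n = begin
    mul f (linear u v) n
      ≈⟨ mul-distribˡ f (scal u one) (scal v zSeries) n ⟩
    mul f (scal u one) n + mul f (scal v zSeries) n
      ≈⟨ +-cong (mul-scalʳ u f one n) (mul-scalʳ v f zSeries n) ⟩
    u * mul f one n + v * mul f zSeries n
      ≈⟨ +-cong (*-cong refl (mul-identityʳ f n)) (*-cong refl (mul-z f n)) ⟩
    u * f n + v * shiftZ 1 f n ∎

  drop-step : ∀ x h g → (∀ n → g (suc n) ≈ h (suc n) + x * g n) → ∀ N →
    drop N h ≋ add (linear (h N) (- (x * g N))) (shiftZ 1 (mul (oneMinus x) (drop (suc N) g)))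
  drop-step x h g rec N zero = sym (begin
    (h N * 1# + - (x * g N) * 0#) + 0#   ≈⟨ +-identityʳ _ ⟩
    h N * 1# + - (x * g N) * 0#          ≈⟨ +-cong (*-identityʳ _) (zeroʳ _) ⟩
    h N + 0#                             ≈⟨ +-identityʳ _ ⟩
    h N                                  ∎)
  drop-step x h g rec N (suc zero) = sym (begin
    (h N * 0# + - (x * g N) * 1#) + mul (oneMinus x) (drop (suc N) g) 0
      ≈⟨ +-cong (trans (+-cong (zeroʳ _) (*-identityʳ _)) (+-identityˡ _))
                (trans (mul-oneMinus₀ x (drop (suc N) g)) (rec N)) ⟩
    - (x * g N) + (h (suc N) + x * g N)
      ≈⟨ cancelˡ _ _ ⟩
    h (suc N) ∎)
  drop-step x h g rec N (suc (suc j)) = sym (begin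
    (h N * 0# + - (x * g N) * 0#) + mul (oneMinus x) (drop (suc N) g) (suc j)
      ≈⟨ +-cong (trans (+-cong (zeroʳ _) (zeroʳ _)) (+-identityʳ 0#))
                (mul-oneMinusₛ x (drop (suc N) g) j) ⟩
    0# + (g (suc i) - x * g i)
      ≈⟨ trans (+-identityˡ _) (+-cong (rec i) refl) ⟩
    (h (suc i) + x * g i) - x * g i
      ≈⟨ cancelʳ _ _ ⟩
    h (suc i)
      ≈⟨ reflexive (≡.cong (λ t → h (suc t)) (ℕ.+-suc j N)) ⟩
    h (suc (suc (j +ℕ N))) ∎)
    where
    i : ℕ
    i = j +ℕ suc N

  module Telescoping (a q : Carrier) (F : Series) where

    x : ℕ → Carrier
    x N = a * pow q N

    Y : ℕ → Series
    Y N = mul F (invPoch a q N)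

    Y-rec : ∀ N n → Y (suc N) (suc n) ≈ Y N (suc n) + x N * Y (suc N) n
    Y-rec N n = begin
      Y (suc N) (suc n)                              ≈⟨ Y-geo (suc n) ⟩
      mul (geo (x N)) (Y N) (suc n)                  ≈⟨ mul-geoₛ (x N) (Y N) n ⟩
      Y N (suc n) + x N * mul (geo (x N)) (Y N) n    ≈⟨ +-cong refl (*-cong refl (Y-geo n)) ⟨
      Y N (suc n) + x N * Y (suc N) n                ∎
      where
      Y-geo : Y (suc N) ≋ mul (geo (x N)) (Y N)
      Y-geo n = trans (sym (mul-assoc F (invPoch a q N) (geo (x N)) n))
                      (mul-comm (Y N) (geo (x N)) n)

    -- z^N (az;q)_N · drop N (Y N): what is left of F after N steps
    remainder : ℕ → Series
    remainder N = shiftZ N (mul (poch a q N) (drop N (Y N)))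

    term : ℕ → Series
    term k m = Y k k * basis a q k m - (x k * Y (suc k) k) * zBasis a q k m

    -- One step of the telescoping, from drop-step applied to Y_N = (1 - x_N z) Y_{N+1}.
    remainder-step : ∀ N m → remainder N m ≈ term N m + remainder (suc N) m
    remainder-step N m = begin
      shiftZ N (mul P (drop N (Y N))) m
        ≈⟨ shift-cong N (λ n → trans (mul-cong {f = P} (λ _ → refl)
             (drop-step (x N) (Y N) (Y (suc N)) (Y-rec N) N) n)
             (mul-distribˡ P (linear u v) (shiftZ 1 (mul (oneMinus (x N)) T)) n)) m ⟩
      shiftZ N (add (mul P (linear u v)) (mul P (shiftZ 1 (mul (oneMinus (x N)) T)))) m
        ≈⟨ shift-add N _ _ m ⟩
      shiftZ N (mul P (linear u v)) m + shiftZ N (mul P (shiftZ 1 (mul (oneMinus (x N)) T))) m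
        ≈⟨ +-cong (shift-cong N (mul-linear P u v) m) (shift-cong N absorb m) ⟩
      shiftZ N (add (scal u P) (scal v (shiftZ 1 P))) m
        + shiftZ N (shiftZ 1 (mul (poch a q (suc N)) T)) m
        ≈⟨ +-cong (shift-add N _ _ m) (shift-suc N _ m) ⟩
      (shiftZ N (scal u P) m + shiftZ N (scal v (shiftZ 1 P)) m) + remainder (suc N) m
        ≈⟨ +-cong (+-cong (shift-scal N u P m)
                          (trans (shift-scal N v _ m) (*-cong refl (shift-suc N P m)))) refl ⟩
      (u * basis a q N m + v * zBasis a q N m) + remainder (suc N) m
        ≈⟨ +-cong (+-cong refl (sym (-‿distribˡ-* _ _))) refl ⟩
      term N m + remainder (suc N) m ∎
      where
      P : Series
      P = poch a q N
      u v : Carrier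
      u = Y N N
      v = - (x N * Y (suc N) N)
      T : Series
      T = drop (suc N) (Y (suc N))
      absorb : mul P (shiftZ 1 (mul (oneMinus (x N)) T)) ≋ shiftZ 1 (mul (poch a q (suc N)) T)
      absorb n = trans (shift-mulʳ 1 P (mul (oneMinus (x N)) T) n)
        (shift-cong 1 (λ i → sym (mul-assoc P (oneMinus (x N)) T i)) n)

    telescope : ∀ N m → F m ≈ sumTo (λ k → term k m) N + remainder N m
    telescope zero m = begin
      F m             ≈⟨ reflexive (≡.cong F (≡.sym (ℕ.+-identityʳ m))) ⟩
      F (m +ℕ 0)      ≈⟨ mul-identityʳ F (m +ℕ 0) ⟨
      Y 0 (m +ℕ 0)    ≈⟨ mul-identityˡ (drop 0 (Y 0)) m ⟨
      remainder 0 m   ≈⟨ +-identityˡ _ ⟨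
      0# + remainder 0 m ∎
    telescope (suc N) m = trans (telescope N m)
      (trans (+-cong refl (remainder-step N m)) (sym (+-assoc _ _ _)))

    -- (1), read off at z^m: the remainder after m+1 steps has order > m.
    telescoped : ∀ m → F m ≈ sumTo (λ k → Y k k * basis a q k m) (suc m)
                             - sumTo (λ k → (x k * Y (suc k) k) * zBasis a q k m) (suc m)
    telescoped m = begin
      F m
        ≈⟨ telescope (suc m) m ⟩
      sumTo (λ k → term k m) (suc m) + remainder (suc m) m
        ≈⟨ trans (+-cong refl (shift-low (suc m) _ m ℕ.≤-refl)) (+-identityʳ _) ⟩
      sumTo (λ k → term k m) (suc m)
        ≈⟨ sumTo-minus _ _ (suc m) ⟩
      sumTo (λ k → Y k k * basis a q k m) (suc m)
        - sumTo (λ k → (x k * Y (suc k) k) * zBasis a q k m) (suc m) ∎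

  -- Formula (2) and the reindexing, under the defining identity of B

  module Hypothesis (a q : Carrier) (B : ℕ → Carrier)
                    (hyp : ∀ m → zSeries m ≈ expansion₁ a q B m) where

    dilated-hypothesis : ∀ c M → c * zSeries M ≈
      sumTo (λ j → B (suc j) * (pow c (suc j) * basis (a * c) q (suc j) M)) M
    dilated-hypothesis c M = begin
      c * zSeries M
        ≈⟨ dilate-z c M ⟨
      pow c M * zSeries M
        ≈⟨ *-cong refl (hyp M) ⟩
      pow c M * sumTo (λ j → B (suc j) * basis a q (suc j) M) M
        ≈⟨ sumTo-*ˡ _ _ M ⟩
      sumTo (λ j → pow c M * (B (suc j) * basis a q (suc j) M)) M
        ≈⟨ sumTo-cong M (λ j _ → trans (solve 3 (λ u v w → u :* (v :* w) := v :* (u :* w)) refl _ _ _)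
             (*-cong refl (dilate-basis c a q (suc j) M))) ⟩
      sumTo (λ j → B (suc j) * (pow c (suc j) * basis (a * c) q (suc j) M)) M ∎

    hypothesis-shifted : ∀ k m → pow q k * zBasis a q k m ≈
      sumTo (λ j → (B (suc j) * pow q (suc j *ℕ k)) * basis a q (k +ℕ suc j) m) m
    hypothesis-shifted k m = begin
      qᵏ * zBasis a q k m
        ≈⟨ *-cong refl (basis-z a q k m) ⟨
      qᵏ * mul (basis a q k) zSeries m
        ≈⟨ mul-scalʳ qᵏ (basis a q k) zSeries m ⟨
      mul (basis a q k) (scal qᵏ zSeries) m
        ≈⟨ mul-cong {f = basis a q k} (λ _ → refl) (dilated-hypothesis qᵏ) m ⟩
      mul (basis a q k) (λ M → sumTo (λ j → u j M) M) m
        ≈⟨ mul-locallyFinite (basis a q k) u u-low m ⟩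
      sumTo (λ j → mul (basis a q k) (u j) m) m
        ≈⟨ sumTo-cong m (λ j _ → u-term j) ⟩
      sumTo (λ j → (B (suc j) * pow q (suc j *ℕ k)) * basis a q (k +ℕ suc j) m) m ∎
      where
      qᵏ : Carrier
      qᵏ = pow q k
      u : ℕ → Series
      u j M = B (suc j) * (pow qᵏ (suc j) * basis (a * qᵏ) q (suc j) M)
      u-low : ∀ j M → M ≤ j → u j M ≈ 0#
      u-low j M M≤j = trans (*-cong refl (trans (*-cong refl
        (shift-low (suc j) _ M (s≤s M≤j))) (zeroʳ _))) (zeroʳ _)
      u-term : ∀ j → mul (basis a q k) (u j) m ≈
                     (B (suc j) * pow q (suc j *ℕ k)) * basis a q (k +ℕ suc j) m
      u-term j = begin
        mul (basis a q k) (u j) m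
          ≈⟨ mul-cong {f = basis a q k} (λ _ → refl) (λ M → sym (*-assoc (B (suc j)) (pow qᵏ (suc j)) (basis (a * qᵏ) q (suc j) M))) m ⟩
        mul (basis a q k) (scal (B (suc j) * pow qᵏ (suc j)) (basis (a * qᵏ) q (suc j))) m
          ≈⟨ mul-scalʳ _ (basis a q k) (basis (a * qᵏ) q (suc j)) m ⟩
        (B (suc j) * pow qᵏ (suc j)) * mul (basis a q k) (basis (a * qᵏ) q (suc j)) m
          ≈⟨ *-cong (*-cong refl (pow-pow q k (suc j))) (basis-mul a q k (suc j) m) ⟩
        (B (suc j) * pow q (suc j *ℕ k)) * basis a q (k +ℕ suc j) m ∎

    correction : (ℕ → Carrier) → ℕ → Carrier
    correction d n = sumTo (λ k → B (n ∸ k) * pow q ((n ∸ k) *ℕ k) * d k) n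

    -- Inserting (2) into Σ_k d_k q^k z^{k+1}(az;q)_k and collecting z^n (az;q)_n.
    regroup : ∀ d m → sumTo (λ n → correction d n * basis a q n m) (suc m) ≈
                      sumTo (λ k → d k * (pow q k * zBasis a q k m)) (suc m)
    regroup d m = begin
      sumTo (λ n → correction d n * basis a q n m) (suc m)
        ≈⟨ sumTo-cong (suc m) (λ n _ → sumTo-*ʳ _ _ n) ⟩
      sumTo (λ n → sumTo (G n) n) (suc m)
        ≈⟨ sumTo-triangle G (suc m) ⟩
      sumTo (λ k → sumTo (λ j → G (k +ℕ suc j) k) (m ∸ k)) (suc m)
        ≈⟨ sumTo-cong (suc m) (λ k _ → row k) ⟩
      sumTo (λ k → d k * (pow q k * zBasis a q k m)) (suc m) ∎
      where
      G : ℕ → ℕ → Carrier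
      G n k = (B (n ∸ k) * pow q ((n ∸ k) *ℕ k) * d k) * basis a q n m
      H : ℕ → ℕ → Carrier
      H k j = (B (suc j) * pow q (suc j *ℕ k)) * basis a q (k +ℕ suc j) m
      G-row : ∀ k j → G (k +ℕ suc j) k ≈ d k * H k j
      G-row k j = trans
        (reflexive (≡.cong (λ t → (B t * pow q (t *ℕ k) * d k) * basis a q (k +ℕ suc j) m)
                           (ℕ.m+n∸m≡n k (suc j))))
        (solve 4 (λ b p e y → (b :* p :* e) :* y := e :* ((b :* p) :* y)) refl _ _ _ _)
      -- terms with j ≥ m ∸ k lie in degree > m
      H-low : ∀ k j → m ∸ k ≤ j → d k * H k j ≈ 0#
      H-low k j le = trans (*-cong refl (trans (*-cong refl
        (shift-low (k +ℕ suc j) _ m (ℕ.≤-<-trans (ℕ.m≤n+m∸n m k) (ℕ.+-monoʳ-< k (s≤s le)))))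
        (zeroʳ _))) (zeroʳ _)
      row : ∀ k → sumTo (λ j → G (k +ℕ suc j) k) (m ∸ k) ≈ d k * (pow q k * zBasis a q k m)
      row k = begin
        sumTo (λ j → G (k +ℕ suc j) k) (m ∸ k)   ≈⟨ sumTo-cong (m ∸ k) (λ j _ → G-row k j) ⟩
        sumTo (λ j → d k * H k j) (m ∸ k)        ≈⟨ sumTo-pad _ (ℕ.m∸n≤m m k) (H-low k) ⟨
        sumTo (λ j → d k * H k j) m              ≈⟨ sumTo-*ˡ (d k) (H k) m ⟨
        d k * sumTo (H k) m                      ≈⟨ *-cong refl (hypothesis-shifted k m) ⟨
        d k * (pow q k * zBasis a q k m)         ∎

    correction-expansion : ∀ d m →
      sumTo (λ k → ((a * pow q k) * d k) * zBasis a q k m) (suc m) ≈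
      sumTo (λ n → (a * correction d n) * basis a q n m) (suc m)
    correction-expansion d m = begin
      sumTo (λ k → ((a * pow q k) * d k) * zBasis a q k m) (suc m)
        ≈⟨ sumTo-cong (suc m) (λ k _ → solve 4 (λ x p e z → ((x :* p) :* e) :* z := x :* (e :* (p :* z)))
             refl a (pow q k) (d k) (zBasis a q k m)) ⟩
      sumTo (λ k → a * (d k * (pow q k * zBasis a q k m))) (suc m)
        ≈⟨ sumTo-*ˡ a _ (suc m) ⟨
      a * sumTo (λ k → d k * (pow q k * zBasis a q k m)) (suc m)
        ≈⟨ *-cong refl (regroup d m) ⟨
      a * sumTo (λ n → correction d n * basis a q n m) (suc m)
        ≈⟨ sumTo-*ˡ a _ (suc m) ⟩
      sumTo (λ n → a * (correction d n * basis a q n m)) (suc m)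
        ≈⟨ sumTo-cong (suc m) (λ n _ → sym (*-assoc _ _ _)) ⟩
      sumTo (λ n → (a * correction d n) * basis a q n m) (suc m) ∎

corollary2p3 : ∀ {c ℓ : Level} (R : CommutativeRing c ℓ) →
    let open CommutativeRing R in let open PS R in
    (a q : Carrier) (B : ℕ → Carrier) →
    (∀ m → zSeries m ≈ expansion₁ a q B m) →
    (F : Series) →
    ∀ m → F m ≈ expansion a q (cCoeff a q B F) m
corollary2p3 R a q B hyp F m = begin
  F m
    ≈⟨ telescoped m ⟩
  sumTo (λ n → Y n n * basis a q n m) (suc m)
    - sumTo (λ k → (x k * d k) * zBasis a q k m) (suc m)
    ≈⟨ +-cong refl (-‿cong (correction-expansion d m)) ⟩
  sumTo (λ n → Y n n * basis a q n m) (suc m)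
    - sumTo (λ n → (a * correction d n) * basis a q n m) (suc m)
    ≈⟨ sumTo-minus _ _ (suc m) ⟨
  sumTo (λ n → Y n n * basis a q n m - (a * correction d n) * basis a q n m) (suc m)
    ≈⟨ sumTo-cong (suc m) (λ n _ → sym ([y-z]x≈yx-zx _ _ _)) ⟩
  expansion a q (cCoeff a q B F) m ∎
  where
  open CommutativeRing R
  open PS R
  open import Algebra.Properties.Ring ring using ([y-z]x≈yx-zx)
  open Expansion R
  open Telescoping a q F
  open Hypothesis a q B hyp
  d : ℕ → Carrier
  d k = Y (suc k) k
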